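{- For every integer $g\geq 2$ and real $\varepsilon>0$, there exists $c>0$ such that the following holds for every sufficiently large integer $n$. For every graph $G\subseteq K_n$ with minimum degree at least $(3/4+\varepsilon)n$ and for every triangle $R$ in $K_n$, there are at least $c\, n^{2g-1}$ $g$-spheres rooted at $R$ in $G$.
   Context: For $g\ge 2$ and a triangle $R$ with vertices $\{v,b_1,b_{2g}\}$, a $g$-sphere rooted at $R$ is obtained by adding $2g-1$ new vertices $u,b_2,\dots,b_{2g-1}$ and the edges $vb_j$ for $2\le j\le 2g-1$, $ub_j$ for $1\le j\le 2g$, $b_jb_{j+1}$ for $1\le j\le 2g-1$, and $b_{2g}b_1$ (the edges of $R$ are not part of it). A $g$-sphere rooted at $R$ in $G$ is such a configuration whose added vertices are distinct vertices of $G$ outside $V(R)$ and all of whose edges (excluding those of $R$) are edges of $G$.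
   Formalization: The parameter ε ranges over the positive rationals rather than the positive reals, and the constant c is taken rational. -}

module Defs where

open import Data.Nat using (ℕ; _*_; _∸_)
open import Data.Bool using (Bool; true; false; if_then_else_)
open import Data.Fin using (Fin)
open import Data.Fin.Base using ()
open import Data.List using (List; []; _∷_; _++_; [_]; map; allFin)
open import Data.Nat.ListAction using (sum)
open import Data.Vec using (Vec; toList)
open import Data.Product using (_×_; _,_)
open import Data.Integer using (+_)
open import Data.Rational using (ℚ; _/_)
open import Data.List.Relation.Unary.All using (All)
open import Data.List.Relation.Unary.Linked using (Linked)
open import Data.List.Relation.Unary.Unique.Propositional using (Unique)
open import Relation.Binary.PropositionalEquality using (_≡_; _≢_)

record Graph (n : ℕ) : Set where
  field
    adj    : Fin n → Fin n → Bool
    sym    : ∀ x y → adj x y ≡ adj y x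
    irrefl : ∀ x → adj x x ≡ false
open Graph public

Edge : ∀ {n} → Graph n → Fin n → Fin n → Set
Edge G x y = adj G x y ≡ true

degree : ∀ {n} → Graph n → Fin n → ℕ
degree {n} G x = sum (map (λ y → if adj G x y then 1 else 0) (allFin n))

toℚ : ℕ → ℚ
toℚ k = + k / 1

-- The added vertices of a g-sphere: u together with (b_2, …, b_{2g-1}).
SphereData : ℕ → ℕ → Set
SphereData n g = Fin n × Vec (Fin n) (2 * g ∸ 2)

-- (u , b_2 … b_{2g-1}) forms a g-sphere rooted at the triangle with
-- vertices v, b_1, b_{2g} (labelled in this way) in G:
--  * the added vertices u, b_2, …, b_{2g-1} are distinct and outside {v,b_1,b_{2g}};
--  * v b_j ∈ E(G) for 2 ≤ j ≤ 2g-1;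
--  * u b_j ∈ E(G) for 1 ≤ j ≤ 2g;
--  * b_j b_{j+1} ∈ E(G) for 1 ≤ j ≤ 2g-1
--  (b_{2g} b_1 is an edge of R, hence not required).
IsRootedSphere : ∀ {n} → Graph n → (g : ℕ) → (v b₁ b₂g : Fin n) → SphereData n g → Set
IsRootedSphere G g v b₁ b₂g (u , mids) =
  Unique (u ∷ toList mids) ×
  All (λ x → x ≢ v × x ≢ b₁ × x ≢ b₂g) (u ∷ toList mids) ×
  All (Edge G v) (toList mids) ×
  All (Edge G u) (b₁ ∷ toList mids ++ [ b₂g ]) ×
  Linked (Edge G) (b₁ ∷ toList mids ++ [ b₂g ])

{-# OPTIONS --safe #-}
module Submission where

-- If ε ≥ 1/m, every vertex misses at most (1/4 − 1/m)n vertices, so any k ≤ 4 vertices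
-- have at least n − k(1/4 − 1/m)n ≥ 4n/m common neighbours. A g-sphere can therefore be
-- built greedily: first the apex u, a common neighbour of v, b₁ and b_{2g}; then b₂, …,
-- b_{2g−1} in turn, each a common neighbour of v, u, its predecessor and b_{2g} avoiding
-- the vertices already used. Once n ≥ m(2g + 2) every one of these 2g − 1 choices has at
-- least n/m options, and different choices give different spheres, so there are at least
-- (n/m)^{2g−1} of them.

module Combinatorics where

  open import Defs hiding (sym)
  open import Data.Bool using (Bool; true; false; T; T?; not; _∧_; if_then_else_)
  open import Data.Bool.Properties using (T-∧; T-≡)
  open import Data.Fin using (Fin; _≟_)
  open import Data.List using (List; []; _∷_; _++_; [_]; map; length; allFin; filterᵇ)
  open import Data.List.Properties using (length-++; length-map; length-tabulate; filter-all)
  open import Data.List.Membership.Propositional using (_∈_)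
  open import Data.List.Membership.Propositional.Properties using (∈-map⁻; ∈-++⁻; ∈-filter⁻)
  open import Data.List.Relation.Unary.All using (All; []; _∷_)
  import Data.List.Relation.Unary.All as All
  import Data.List.Relation.Unary.All.Properties as All
  open import Data.List.Relation.Unary.Any using (here; there)
  open import Data.List.Relation.Unary.Linked using (Linked; [-]; _∷_)
  open import Data.List.Relation.Unary.Unique.Propositional using (Unique; []; _∷_)
  import Data.List.Relation.Unary.Unique.Propositional.Properties as Unique
  open import Data.Nat using (ℕ; zero; suc; _+_; _*_; _^_; _∸_; _≤_; z≤n; s≤s; NonZero; ≢-nonZero)
  open import Data.Nat.ListAction using (sum)
  open import Data.Nat.Properties hiding (_≟_)
  open import Data.Nat.Tactic.RingSolver using (solve-∀)
  open import Data.Product using (_×_; _,_; proj₁; proj₂; ∃-syntax)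
  open import Data.Product.Properties using (,-injective)
  open import Data.Sum using (inj₁; inj₂)
  open import Data.Vec using (Vec; []; _∷_; toList)
  import Data.Vec.Properties as Vec
  open import Function using (_∘_; Equivalence)
  open import Relation.Binary.PropositionalEquality
    using (_≡_; _≢_; refl; sym; trans; cong; subst; ≢-sym; module ≡-Reasoning)
  open import Relation.Nullary using (¬_; yes; no)
  open import Relation.Nullary.Decidable using (⌊_⌋; fromWitnessFalse; toWitnessFalse)

  module _ {A B C : Set} where

    dependentProductWith : (A → B → C) → List A → (A → List B) → List C
    dependentProductWith f []       F = []
    dependentProductWith f (x ∷ xs) F = map (f x) (F x) ++ dependentProductWith f xs F

    ∈-dependentProductWith⁻ : ∀ (f : A → B → C) xs F {z} → z ∈ dependentProductWith f xs F →
                              ∃[ x ] ∃[ y ] (x ∈ xs × y ∈ F x × z ≡ f x y)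
    ∈-dependentProductWith⁻ f (x ∷ xs) F z∈ with ∈-++⁻ (map (f x) (F x)) z∈
    ... | inj₁ z∈map with ∈-map⁻ (f x) z∈map
    ...   | y , y∈ , refl = x , y , here refl , y∈ , refl
    ∈-dependentProductWith⁻ f (x ∷ xs) F z∈ | inj₂ z∈rest with ∈-dependentProductWith⁻ f xs F z∈rest
    ... | x′ , y , x′∈ , y∈ , refl = x′ , y , there x′∈ , y∈ , refl

    All-dependentProductWith : ∀ {P : C → Set} (f : A → B → C) xs F →
                               (∀ {x} → x ∈ xs → All (P ∘ f x) (F x)) →
                               All P (dependentProductWith f xs F)
    All-dependentProductWith f []       F all = []
    All-dependentProductWith f (x ∷ xs) F all =
      All.++⁺ (All.map⁺ (all (here refl))) (All-dependentProductWith f xs F (all ∘ there))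

    Unique-dependentProductWith : ∀ (f : A → B → C) → (∀ {w x y z} → f w y ≡ f x z → w ≡ x × y ≡ z) →
                                  ∀ {xs} F → Unique xs → (∀ {x} → x ∈ xs → Unique (F x)) →
                                  Unique (dependentProductWith f xs F)
    Unique-dependentProductWith f f-inj F []           uniq = []
    Unique-dependentProductWith f f-inj {x ∷ xs} F (x∉xs ∷ xs!) uniq =
      Unique.++⁺ (Unique.map⁺ (proj₂ ∘ f-inj) (uniq (here refl)))
                 (Unique-dependentProductWith f f-inj F xs! (uniq ∘ there))
                 disjoint
      where
      disjoint : ∀ {z} → ¬ (z ∈ map (f x) (F x) × z ∈ dependentProductWith f xs F)
      disjoint (z∈map , z∈rest) with ∈-map⁻ (f x) z∈map | ∈-dependentProductWith⁻ f xs F z∈rest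
      ... | y , _ , refl | x′ , y′ , x′∈ , _ , e = All.lookup x∉xs x′∈ (proj₁ (f-inj e))

    length-dependentProductWith : ∀ (f : A → B → C) xs F {a c} →
                                  (∀ {x} → x ∈ xs → a ≤ c * length (F x)) →
                                  length xs * a ≤ c * length (dependentProductWith f xs F)
    length-dependentProductWith f []       F bound = z≤n
    length-dependentProductWith f (x ∷ xs) F {a} {c} bound = begin
      a + length xs * a
        ≤⟨ +-mono-≤ (bound (here refl)) (length-dependentProductWith f xs F {c = c} (bound ∘ there)) ⟩
      c * length (F x) + c * length rest
        ≡⟨ *-distribˡ-+ c (length (F x)) (length rest) ⟨
      c * (length (F x) + length rest)
        ≡⟨ cong (λ l → c * (l + length rest)) (length-map (f x) (F x)) ⟨
      c * (length (map (f x) (F x)) + length rest)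
        ≡⟨ cong (c *_) (length-++ (map (f x) (F x))) ⟨
      c * length (map (f x) (F x) ++ rest) ∎
      where
      open ≤-Reasoning
      rest : List C
      rest = dependentProductWith f xs F

    length-dependentProductWith-^ : ∀ (f : A → B → C) xs F {a b k} → a ≤ b * length xs →
                                    (∀ {x} → x ∈ xs → a ^ k ≤ b ^ k * length (F x)) →
                                    a ^ suc k ≤ b ^ suc k * length (dependentProductWith f xs F)
    length-dependentProductWith-^ f xs F {a} {b} {k} root branches = begin
      a * a ^ k                   ≤⟨ *-monoˡ-≤ (a ^ k) root ⟩
      b * length xs * a ^ k       ≡⟨ *-assoc b (length xs) (a ^ k) ⟩
      b * (length xs * a ^ k)     ≤⟨ *-monoʳ-≤ b (length-dependentProductWith f xs F {c = b ^ k} branches) ⟩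
      b * (b ^ k * length pairs)  ≡⟨ *-assoc b (b ^ k) (length pairs) ⟨
      b * b ^ k * length pairs    ∎
      where
      open ≤-Reasoning
      pairs : List C
      pairs = dependentProductWith f xs F

  +-suc-mono : ∀ {a b c d} → a + b ≤ c + d → a + suc b ≤ c + suc d
  +-suc-mono {a} {b} {c} {d} le rewrite +-suc a b | +-suc c d = s≤s le

  module _ {A : Set} where

    length-filterᵇ-∧ : ∀ (p q : A → Bool) xs →
                       length (filterᵇ p xs) + length (filterᵇ q xs) ≤
                       length (filterᵇ (λ y → p y ∧ q y) xs) + length xs
    length-filterᵇ-∧ p q []       = z≤n
    length-filterᵇ-∧ p q (x ∷ xs) with p x | q x | length-filterᵇ-∧ p q xs
    ... | true  | true  | ih = s≤s (+-suc-mono ih)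
    ... | true  | false | ih = ≤-trans (s≤s ih) (≤-reflexive (sym (+-suc _ _)))
    ... | false | true  | ih = +-suc-mono ih
    ... | false | false | ih = ≤-trans ih (+-monoʳ-≤ _ (n≤1+n _))

    sum-indicator : ∀ (p : A → Bool) xs →
                    sum (map (λ y → if p y then 1 else 0) xs) ≡ length (filterᵇ p xs)
    sum-indicator p []       = refl
    sum-indicator p (x ∷ xs) with p x
    ... | true  = cong suc (sum-indicator p xs)
    ... | false = sum-indicator p xs

  module _ {n : ℕ} where

    _≢ᵇ_ : Fin n → Fin n → Bool
    y ≢ᵇ z = not ⌊ y ≟ z ⌋

    length-filterᵇ-≢ : ∀ z xs → Unique xs → length xs ≤ length (filterᵇ (_≢ᵇ z) xs) + 1
    length-filterᵇ-≢ z []       []           = z≤n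
    length-filterᵇ-≢ z (x ∷ xs) (x∉xs ∷ xs!) with x ≟ z
    ... | yes refl = ≤-reflexive (begin
      suc (length xs)                      ≡⟨ +-comm 1 (length xs) ⟩
      length xs + 1                        ≡⟨ cong (λ ys → length ys + 1) (filter-all _ others-kept) ⟨
      length (filterᵇ (_≢ᵇ x) xs) + 1      ∎)
      where
      open ≡-Reasoning
      others-kept : All (T ∘ (_≢ᵇ x)) xs
      others-kept = All.map (λ x≢y → fromWitnessFalse (x≢y ∘ sym)) x∉xs
    ... | no  _    = s≤s (length-filterᵇ-≢ z xs xs!)

    count : (Fin n → Bool) → ℕ
    count p = length (filterᵇ p (allFin n))

    count-∧ : ∀ p q → count p + count q ≤ count (λ y → p y ∧ q y) + n
    count-∧ p q = subst (λ l → count p + count q ≤ count (λ y → p y ∧ q y) + l)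
                        (length-tabulate _) (length-filterᵇ-∧ p q (allFin n))

    count-∧-deficit : ∀ {p q a b} → n ≤ count p + a → n ≤ count q + b →
                      n ≤ count (λ y → p y ∧ q y) + (a + b)
    count-∧-deficit {p} {q} {a} {b} pa qb = +-cancelˡ-≤ n n _ (begin
      n + n                                   ≤⟨ +-mono-≤ pa qb ⟩
      (count p + a) + (count q + b)           ≡⟨ shuffle (count p) a (count q) b ⟩
      (count p + count q) + (a + b)           ≤⟨ +-monoˡ-≤ (a + b) (count-∧ p q) ⟩
      (count (λ y → p y ∧ q y) + n) + (a + b) ≡⟨ shuffle′ (count (λ y → p y ∧ q y)) n (a + b) ⟩
      n + (count (λ y → p y ∧ q y) + (a + b)) ∎)
      where
      open ≤-Reasoning
      shuffle : ∀ w x y z → (w + x) + (y + z) ≡ (w + y) + (x + z)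
      shuffle = solve-∀
      shuffle′ : ∀ x y z → (x + y) + z ≡ y + (x + z)
      shuffle′ = solve-∀

    fresh : List (Fin n) → Fin n → Bool
    fresh []       y = true
    fresh (z ∷ zs) y = y ≢ᵇ z ∧ fresh zs y

    fresh-sound : ∀ zs {y} → T (fresh zs y) → All (y ≢_) zs
    fresh-sound []       _ = []
    fresh-sound (z ∷ zs) t with Equivalence.to T-∧ t
    ... | y≢z , rest = toWitnessFalse y≢z ∷ fresh-sound zs rest

    count-fresh : ∀ used → n ≤ count (fresh used) + length used
    count-fresh []       = ≤-reflexive (sym (begin
      count (fresh []) + 0 ≡⟨ +-identityʳ _ ⟩
      count (fresh [])     ≡⟨ cong length (filter-all _ (All.universal _ (allFin n))) ⟩
      length (allFin n)    ≡⟨ length-tabulate _ ⟩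
      n                    ∎))
      where open ≡-Reasoning
    count-fresh (z ∷ zs) =
      count-∧-deficit (subst (_≤ count (_≢ᵇ z) + 1) (length-tabulate _)
                             (length-filterᵇ-≢ z (allFin n) (Unique.allFin⁺ n)))
                      (count-fresh zs)

  module _ {n : ℕ} (G : Graph n) where

    degree≡count : ∀ x → degree G x ≡ count (adj G x)
    degree≡count x = sum-indicator (adj G x) (allFin n)

    edge-sym : ∀ {x y} → Edge G x y → Edge G y x
    edge-sym {x} {y} e = trans (Graph.sym G y x) e

    edge⇒≢ : ∀ {x y} → Edge G x y → y ≢ x
    edge⇒≢ {x} e refl with trans (sym (irrefl G x)) e
    ... | ()

    isCommonNeighbourOutside : List (Fin n) → List (Fin n) → Fin n → Bool
    isCommonNeighbourOutside []       used y = fresh used y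
    isCommonNeighbourOutside (x ∷ xs) used y = adj G x y ∧ isCommonNeighbourOutside xs used y

    commonNeighboursOutside : List (Fin n) → List (Fin n) → List (Fin n)
    commonNeighboursOutside xs used = filterᵇ (isCommonNeighbourOutside xs used) (allFin n)

    ∈-commonNeighboursOutside⁻ : ∀ xs used {y} → y ∈ commonNeighboursOutside xs used →
                                 All (λ x → Edge G x y) xs × All (y ≢_) used
    ∈-commonNeighboursOutside⁻ xs used y∈ =
      sound xs (proj₂ (∈-filter⁻ (T? ∘ isCommonNeighbourOutside xs used) {xs = allFin n} y∈))
      where
      sound : ∀ xs {y} → T (isCommonNeighbourOutside xs used y) →
              All (λ x → Edge G x y) xs × All (y ≢_) used
      sound []       t = [] , fresh-sound used t
      sound (x ∷ xs) t with Equivalence.to T-∧ t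
      ... | xy , rest with sound xs rest
      ...   | edges , avoids = Equivalence.to T-≡ xy ∷ edges , avoids

    commonNeighboursOutside-unique : ∀ xs used → Unique (commonNeighboursOutside xs used)
    commonNeighboursOutside-unique xs used =
      Unique.filter⁺ (T? ∘ isCommonNeighbourOutside xs used) (Unique.allFin⁺ n)

    bonferroni-commonNeighboursOutside : ∀ xs used →
      sum (map (degree G) xs) + count (fresh used) ≤ length (commonNeighboursOutside xs used) + length xs * n
    bonferroni-commonNeighboursOutside []       used = ≤-reflexive (+-comm 0 _)
    bonferroni-commonNeighboursOutside (x ∷ xs) used = begin
      degree G x + sum (map (degree G) xs) + count (fresh used)
        ≡⟨ +-assoc (degree G x) _ _ ⟩
      degree G x + (sum (map (degree G) xs) + count (fresh used))
        ≤⟨ +-mono-≤ (≤-reflexive (degree≡count x)) (bonferroni-commonNeighboursOutside xs used) ⟩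
      count (adj G x) + (count (isCommonNeighbourOutside xs used) + length xs * n)
        ≡⟨ +-assoc (count (adj G x)) _ _ ⟨
      count (adj G x) + count (isCommonNeighbourOutside xs used) + length xs * n
        ≤⟨ +-monoˡ-≤ (length xs * n) (count-∧ (adj G x) (isCommonNeighbourOutside xs used)) ⟩
      count (isCommonNeighbourOutside (x ∷ xs) used) + n + length xs * n
        ≡⟨ +-assoc (count (isCommonNeighbourOutside (x ∷ xs) used)) n _ ⟩
      count (isCommonNeighbourOutside (x ∷ xs) used) + (n + length xs * n) ∎
      where open ≤-Reasoning

  -- δ(G) ≥ (3/4 + 1/m)·n, with the denominators cleared.
  HighMinDegree : ∀ {n} → Graph n → ℕ → Set
  HighMinDegree {n} G m = ∀ x → (3 * m + 4) * n ≤ 4 * m * degree G x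

  -- S is the degree sum of k vertices, F and C count the vertices and the common neighbours
  -- outside a set of size U; then C ≥ S + F − kn ≥ k(3/4 + 1/m)n − (k − 1)n − n/m ≥ n/m.
  density-arithmetic : ∀ {m n k S F C U} → 2 ≤ k → k ≤ 4 →
                       k * ((3 * m + 4) * n) ≤ 4 * m * S → S + F ≤ C + k * n →
                       n ≤ F + U → m * U ≤ n → n ≤ m * C
  density-arithmetic {m} {n} {k} {S} {F} {C} {U} 2≤k k≤4 degrees inclusion-exclusion fresh-count few-used =
    +-cancelʳ-≤ n n (m * C) (begin
      n + n     ≡⟨ cong (n +_) (+-identityʳ n) ⟨
      2 * n     ≤⟨ *-monoˡ-≤ n 2≤k ⟩
      k * n     ≤⟨ *-cancelˡ-≤ 4 (+-cancelˡ-≤ (k * (3 * m * n) + 4 * (m * n)) _ _ key) ⟩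
      m * C + n ∎)
    where
    open ≤-Reasoning
    key : (k * (3 * m * n) + 4 * (m * n)) + 4 * (k * n) ≤ (k * (3 * m * n) + 4 * (m * n)) + 4 * (m * C + n)
    key = begin
      (k * (3 * m * n) + 4 * (m * n)) + 4 * (k * n)
        ≡⟨ e₁ k m n ⟩
      k * ((3 * m + 4) * n) + 4 * m * n
        ≤⟨ +-mono-≤ degrees (*-monoʳ-≤ (4 * m) fresh-count) ⟩
      4 * m * S + 4 * m * (F + U)
        ≡⟨ e₂ m S F U ⟩
      4 * m * (S + F) + 4 * (m * U)
        ≤⟨ +-mono-≤ (*-monoʳ-≤ (4 * m) inclusion-exclusion) (*-monoʳ-≤ 4 few-used) ⟩
      4 * m * (C + k * n) + 4 * n
        ≡⟨ e₃ k m n C ⟩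
      (k * (3 * m * n) + k * (m * n)) + 4 * (m * C + n)
        ≤⟨ +-monoˡ-≤ (4 * (m * C + n)) (+-monoʳ-≤ (k * (3 * m * n)) (*-monoˡ-≤ (m * n) k≤4)) ⟩
      (k * (3 * m * n) + 4 * (m * n)) + 4 * (m * C + n) ∎
      where
      e₁ : ∀ k m n → (k * (3 * m * n) + 4 * (m * n)) + 4 * (k * n) ≡ k * ((3 * m + 4) * n) + 4 * m * n
      e₁ = solve-∀
      e₂ : ∀ m S F U → 4 * m * S + 4 * m * (F + U) ≡ 4 * m * (S + F) + 4 * (m * U)
      e₂ = solve-∀
      e₃ : ∀ k m n C → 4 * m * (C + k * n) + 4 * n ≡ (k * (3 * m * n) + k * (m * n)) + 4 * (m * C + n)
      e₃ = solve-∀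

  module _ {n : ℕ} (G : Graph n) (m : ℕ) (dense : HighMinDegree G m) where

    sum-degree-bound : ∀ xs → length xs * ((3 * m + 4) * n) ≤ 4 * m * sum (map (degree G) xs)
    sum-degree-bound []       = z≤n
    sum-degree-bound (x ∷ xs) = begin
      (3 * m + 4) * n + length xs * ((3 * m + 4) * n)
        ≤⟨ +-mono-≤ (dense x) (sum-degree-bound xs) ⟩
      4 * m * degree G x + 4 * m * sum (map (degree G) xs)
        ≡⟨ *-distribˡ-+ (4 * m) (degree G x) _ ⟨
      4 * m * (degree G x + sum (map (degree G) xs)) ∎
      where open ≤-Reasoning

    length-commonNeighboursOutside : ∀ xs used → 2 ≤ length xs → length xs ≤ 4 → m * length used ≤ n →
                                     n ≤ m * length (commonNeighboursOutside G xs used)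
    length-commonNeighboursOutside xs used 2≤k k≤4 few-used =
      density-arithmetic {m = m} 2≤k k≤4 (sum-degree-bound xs)
        (bonferroni-commonNeighboursOutside G xs used) (count-fresh used) few-used

  module _ {n : ℕ} (G : Graph n) (v u b₂g : Fin n) where

    extensions : Fin n → List (Fin n) → List (Fin n)
    extensions prev used = commonNeighboursOutside G (v ∷ u ∷ prev ∷ b₂g ∷ []) used

    -- rims k b₁ used lists the greedy choices of b₂ … b_{k+1}. Every rim vertex, not only the
    -- last, must be adjacent to b₂g: this keeps the choice rule uniform.
    rims : (k : ℕ) → Fin n → List (Fin n) → List (Vec (Fin n) k)
    rims zero    prev used = [ [] ]
    rims (suc k) prev used =
      dependentProductWith _∷_ (extensions prev used) (λ x → rims k x (x ∷ used))

    IsRimFrom : ∀ {k} → Fin n → List (Fin n) → Vec (Fin n) k → Set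
    IsRimFrom prev used bs =
      Unique (toList bs) × All (λ b → All (b ≢_) used) (toList bs) ×
      All (Edge G v) (toList bs) × All (Edge G u) (toList bs) ×
      Linked (Edge G) (prev ∷ toList bs ++ [ b₂g ])

    IsRimFrom-[_] : ∀ {prev used x} → x ∈ extensions prev used → IsRimFrom prev used (x ∷ [])
    IsRimFrom-[_] {prev} {used} x∈ with ∈-commonNeighboursOutside⁻ G (v ∷ u ∷ prev ∷ b₂g ∷ []) used x∈
    ... | vx ∷ ux ∷ prev-x ∷ b₂g-x ∷ [] , x-fresh =
      ([] ∷ []) , (x-fresh ∷ []) , (vx ∷ []) , (ux ∷ []) , (prev-x ∷ edge-sym G b₂g-x ∷ [-])

    IsRimFrom-∷ : ∀ {prev used x k} {bs : Vec (Fin n) k} → x ∈ extensions prev used →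
                  IsRimFrom x (x ∷ used) bs → IsRimFrom prev used (x ∷ bs)
    IsRimFrom-∷ {prev} {used} x∈ (bs! , bs-fresh , bs-v , bs-u , linked)
      with ∈-commonNeighboursOutside⁻ G (v ∷ u ∷ prev ∷ b₂g ∷ []) used x∈
    ... | vx ∷ ux ∷ prev-x ∷ _ ∷ [] , x-fresh =
      (All.map (≢-sym ∘ All.head) bs-fresh ∷ bs!) , (x-fresh ∷ All.map All.tail bs-fresh) ,
      (vx ∷ bs-v) , (ux ∷ bs-u) , (prev-x ∷ linked)

    -- For k = 0 the rim would need the edge prev b₂g, which nothing provides.
    rims-valid : ∀ k .{{_ : NonZero k}} prev used → All (IsRimFrom prev used) (rims k prev used)
    rims-valid (suc zero)    prev used =
      All-dependentProductWith _∷_ (extensions prev used) _ (λ x∈ → IsRimFrom-[ x∈ ] ∷ [])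
    rims-valid (suc (suc k)) prev used =
      All-dependentProductWith _∷_ (extensions prev used) _
        (λ {x} x∈ → All.map (IsRimFrom-∷ x∈) (rims-valid (suc k) x (x ∷ used)))

    rims-unique : ∀ k prev used → Unique (rims k prev used)
    rims-unique zero    prev used = [] ∷ []
    rims-unique (suc k) prev used =
      Unique-dependentProductWith _∷_ Vec.∷-injective (λ x → rims k x (x ∷ used))
        (commonNeighboursOutside-unique G (v ∷ u ∷ prev ∷ b₂g ∷ []) used)
        (λ {x} _ → rims-unique k x (x ∷ used))

    rims-length : ∀ m → HighMinDegree G m → ∀ k prev used → m * (length used + k) ≤ n →
                  n ^ k ≤ m ^ k * length (rims k prev used)
    rims-length m dense zero    prev used _    = ≤-refl
    rims-length m dense (suc k) prev used room =
      length-dependentProductWith-^ _∷_ (extensions prev used) (λ x → rims k x (x ∷ used)) {b = m} {k = k}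
        (length-commonNeighboursOutside G m dense (v ∷ u ∷ prev ∷ b₂g ∷ []) used (s≤s (s≤s z≤n)) ≤-refl
          (≤-trans (*-monoʳ-≤ m (m≤m+n (length used) (suc k))) room))
        (λ {x} _ → rims-length m dense k x (x ∷ used)
                     (subst (λ l → m * l ≤ n) (+-suc (length used) k) room))

  module _ {n : ℕ} (G : Graph n) (v b₁ b₂g : Fin n) where

    -- The apex need not be adjacent to v; asking for it makes u ≢ v automatic.
    apexes : List (Fin n)
    apexes = commonNeighboursOutside G (v ∷ b₁ ∷ b₂g ∷ []) []

    reserved : Fin n → List (Fin n)
    reserved u = u ∷ b₁ ∷ b₂g ∷ v ∷ []

    spheres : (k : ℕ) → List (Fin n × Vec (Fin n) k)
    spheres k = dependentProductWith _,_ apexes (λ u → rims G v u b₂g k b₁ (reserved u))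

    sphere-rooted : ∀ g {u} {bs : Vec (Fin n) (2 * g ∸ 2)} → u ∈ apexes →
                    IsRimFrom G v u b₂g b₁ (reserved u) bs → IsRootedSphere G g v b₁ b₂g (u , bs)
    sphere-rooted g u∈ (bs! , bs-fresh , bs-v , bs-u , linked)
      with ∈-commonNeighboursOutside⁻ G (v ∷ b₁ ∷ b₂g ∷ []) [] u∈
    ... | vu ∷ b₁u ∷ b₂gu ∷ [] , _ =
      (All.map (≢-sym ∘ All.head) bs-fresh ∷ bs!) ,
      ((edge⇒≢ G vu , edge⇒≢ G b₁u , edge⇒≢ G b₂gu) ∷ All.map avoids-triangle bs-fresh) ,
      bs-v , (edge-sym G b₁u ∷ All.++⁺ bs-u (edge-sym G b₂gu ∷ [])) , linked
      where
      avoids-triangle : ∀ {b} → All (b ≢_) (reserved _) → b ≢ v × b ≢ b₁ × b ≢ b₂g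
      avoids-triangle (_ ∷ b≢b₁ ∷ b≢b₂g ∷ b≢v ∷ []) = b≢v , b≢b₁ , b≢b₂g

    spheres-rooted : ∀ g .{{_ : NonZero (2 * g ∸ 2)}} →
                     All (IsRootedSphere G g v b₁ b₂g) (spheres (2 * g ∸ 2))
    spheres-rooted g = All-dependentProductWith _,_ apexes _
      (λ {u} u∈ → All.map (sphere-rooted g u∈) (rims-valid G v u b₂g (2 * g ∸ 2) b₁ (reserved u)))

    spheres-unique : ∀ k → Unique (spheres k)
    spheres-unique k =
      Unique-dependentProductWith _,_ ,-injective (λ u → rims G v u b₂g k b₁ (reserved u))
        (commonNeighboursOutside-unique G (v ∷ b₁ ∷ b₂g ∷ []) [])
        (λ {u} _ → rims-unique G v u b₂g k b₁ (reserved u))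

    spheres-length : ∀ m → HighMinDegree G m → ∀ k → m * (4 + k) ≤ n →
                     n ^ suc k ≤ m ^ suc k * length (spheres k)
    spheres-length m dense k room =
      length-dependentProductWith-^ _,_ apexes (λ u → rims G v u b₂g k b₁ (reserved u)) {b = m} {k = k}
        (length-commonNeighboursOutside G m dense (v ∷ b₁ ∷ b₂g ∷ []) []
          (s≤s (s≤s z≤n)) (s≤s (s≤s (s≤s z≤n))) (≤-trans (≤-reflexive (*-zeroʳ m)) z≤n))
        (λ {u} _ → rims-length G v u b₂g m dense k b₁ (reserved u) room)

  rooted-spheres : ∀ {n} (G : Graph n) m → HighMinDegree G m →
                   ∀ g → 2 ≤ g → m * (4 + (2 * g ∸ 2)) ≤ n → ∀ v b₁ b₂g →
                   ∃[ L ] (Unique L × All (IsRootedSphere G g v b₁ b₂g) L ×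
                           n ^ (2 * g ∸ 1) ≤ m ^ (2 * g ∸ 1) * length L)
  rooted-spheres {n} G m dense g@(suc (suc g′)) (s≤s (s≤s z≤n)) room v b₁ b₂g =
    spheres G v b₁ b₂g k , spheres-unique G v b₁ b₂g k ,
    spheres-rooted G v b₁ b₂g g {{≢-nonZero (m+1+n≢0 g′)}} ,
    spheres-length G v b₁ b₂g m dense k room
    where
    k : ℕ
    k = 2 * g ∸ 2

open import Defs
open import Data.Nat using (ℕ; _≤_; _*_; _∸_; _^_)
open import Data.Fin using (Fin)
open import Data.List using (List; length)
open import Data.Product using (_×_; ∃-syntax)
open import Data.Integer using (+_)
open import Data.Rational using (ℚ; 0ℚ; _/_; _+_) renaming (_*_ to _*ℚ_; _<_ to _<ℚ_; _≤_ to _≤ℚ_)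
open import Data.List.Relation.Unary.All using (All)
open import Data.List.Relation.Unary.Unique.Propositional using (Unique)
open import Relation.Binary.PropositionalEquality using (_≢_)

import Data.Nat as ℕ
open import Function using (_∘_)
open import Data.Nat.Properties
  using (*-monoˡ-≤; +-monoʳ-≤; m≤n*m; *-identityʳ; *-identityˡ; *-comm; m^n≢0; module ≤-Reasoning)
import Data.Integer as ℤ
import Data.Integer.Properties as ℤ
open import Data.Rational using (mkℚ; *<*; ↧ₙ_; toℚᵘ)
open import Data.Rational.Properties
  using (toℚᵘ-fromℚᵘ; toℚᵘ-homo-*; toℚᵘ-homo-+; toℚᵘ-mono-≤; toℚᵘ-cancel-≤; positive⁻¹; normalize-pos)
open import Data.Rational.Unnormalised as ℚᵘ
  using (mkℚᵘ; *≤*) renaming (_≤_ to _≤ᵘ_; _≃_ to _≃ᵘ_)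
import Data.Rational.Unnormalised.Properties as ℚᵘ
open import Data.Product using (_,_)
open import Relation.Binary.PropositionalEquality as ≡ using (cong; subst₂)
open Combinatorics using (rooted-spheres)

toℚᵘ-toℚ : ∀ k → toℚᵘ (toℚ k) ≃ᵘ mkℚᵘ (+ k) 0
toℚᵘ-toℚ k = toℚᵘ-fromℚᵘ (mkℚᵘ (+ k) 0)

≤ᵘ⇒≤ : ∀ {x y d e} → mkℚᵘ (+ x) d ≤ᵘ mkℚᵘ (+ y) e → x * ℕ.suc e ≤ y * ℕ.suc d
≤ᵘ⇒≤ {x} {y} {d} {e} (*≤* le) =
  ℤ.drop‿+≤+ (subst₂ ℤ._≤_ (≡.sym (ℤ.pos-* x (ℕ.suc e))) (≡.sym (ℤ.pos-* y (ℕ.suc d))) le)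

≤⇒≤ᵘ : ∀ {x y d e} → x * ℕ.suc e ≤ y * ℕ.suc d → mkℚᵘ (+ x) d ≤ᵘ mkℚᵘ (+ y) e
≤⇒≤ᵘ {x} {y} {d} {e} le = *≤* (subst₂ ℤ._≤_ (ℤ.pos-* x (ℕ.suc e)) (ℤ.pos-* y (ℕ.suc d)) (ℤ.+≤+ le))

-- ε = (p + 1)/m ≥ 1/m for its denominator m.
clear-denominators : ∀ ε → 0ℚ <ℚ ε → ∀ {a b} → ((+ 3 / 4) + ε) *ℚ toℚ a ≤ℚ toℚ b →
                     (3 * ↧ₙ ε ℕ.+ 4) * a ≤ 4 * ↧ₙ ε * b
clear-denominators ε@(mkℚ ℤ.+[1+ p ] d _) _ {a} {b} le = begin
  (3 * ℕ.suc d ℕ.+ 4) * a                ≤⟨ *-monoˡ-≤ a (+-monoʳ-≤ (3 * ℕ.suc d) (m≤n*m 4 (ℕ.suc p))) ⟩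
  (3 * ℕ.suc d ℕ.+ ℕ.suc p * 4) * a      ≡⟨ *-identityʳ _ ⟨
  (3 * ℕ.suc d ℕ.+ ℕ.suc p * 4) * a * 1  ≤⟨ ≤ᵘ⇒≤ unnormalised ⟩
  b * (4 * ℕ.suc d * 1)                  ≡⟨ cong (b *_) (*-identityʳ _) ⟩
  b * (4 * ℕ.suc d)                      ≡⟨ *-comm b _ ⟩
  4 * ℕ.suc d * b                        ∎
  where
  open ≤-Reasoning
  lhs : toℚᵘ (((+ 3 / 4) + ε) *ℚ toℚ a) ≃ᵘ (mkℚᵘ (+ 3) 3 ℚᵘ.+ toℚᵘ ε) ℚᵘ.* mkℚᵘ (+ a) 0
  lhs = ℚᵘ.≃-trans (toℚᵘ-homo-* ((+ 3 / 4) + ε) (toℚ a))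
          (ℚᵘ.*-cong (ℚᵘ.≃-trans (toℚᵘ-homo-+ (+ 3 / 4) ε)
                                 (ℚᵘ.+-cong (toℚᵘ-fromℚᵘ (mkℚᵘ (+ 3) 3)) (ℚᵘ.≃-refl {toℚᵘ ε})))
                     (toℚᵘ-toℚ a))
  -- Unnormalised arithmetic on literals computes: lhs is this fraction up to a sign normalisation.
  unnormalised : mkℚᵘ (+ ((3 * ℕ.suc d ℕ.+ ℕ.suc p * 4) * a)) _ ≤ᵘ mkℚᵘ (+ b) 0
  unnormalised = ℚᵘ.≤-respˡ-≃ (ℚᵘ.≃-reflexive (cong (λ i → mkℚᵘ i _) (ℤ.+◃n≡+n _)))
                   (ℚᵘ.≤-respʳ-≃ (toℚᵘ-toℚ b) (ℚᵘ.≤-respˡ-≃ lhs (toℚᵘ-mono-≤ le)))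
clear-denominators (mkℚ (+ 0)       _ _) (*<* (ℤ.+<+ ()))
clear-denominators (mkℚ ℤ.-[1+ _ ] _ _) (*<* ())

≤-scale : ∀ q .{{_ : ℕ.NonZero q}} {a b} → a ≤ q * b → (+ 1 / q) *ℚ toℚ a ≤ℚ toℚ b
≤-scale q@(ℕ.suc q′) {a} {b} a≤qb = toℚᵘ-cancel-≤
  (ℚᵘ.≤-respˡ-≃ (ℚᵘ.≃-sym lhs) (ℚᵘ.≤-respʳ-≃ (ℚᵘ.≃-sym (toℚᵘ-toℚ b))
    (ℚᵘ.≤-respˡ-≃ (ℚᵘ.≃-reflexive (cong (λ i → mkℚᵘ i _) (≡.sym (ℤ.+◃n≡+n _)))) (≤⇒≤ᵘ cleared))))
  where
  open ≤-Reasoning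
  lhs : toℚᵘ ((+ 1 / q) *ℚ toℚ a) ≃ᵘ mkℚᵘ (+ 1) q′ ℚᵘ.* mkℚᵘ (+ a) 0
  lhs = ℚᵘ.≃-trans (toℚᵘ-homo-* (+ 1 / q) (toℚ a))
          (ℚᵘ.*-cong (toℚᵘ-fromℚᵘ (mkℚᵘ (+ 1) q′)) (toℚᵘ-toℚ a))
  cleared : 1 * a * 1 ≤ b * ℕ.suc (q′ * 1)
  cleared = begin
    1 * a * 1            ≡⟨ *-identityʳ (1 * a) ⟩
    1 * a                ≡⟨ *-identityˡ a ⟩
    a                    ≤⟨ a≤qb ⟩
    q * b                ≡⟨ *-comm q b ⟩
    b * q                ≡⟨ cong (λ k → b * ℕ.suc k) (*-identityʳ q′) ⟨
    b * ℕ.suc (q′ * 1)   ∎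

proposition5p18 : (g : ℕ) → 2 ≤ g → (ε : ℚ) → 0ℚ <ℚ ε →
    ∃[ c ] (0ℚ <ℚ c × ∃[ n₀ ] ((n : ℕ) → n₀ ≤ n → (G : Graph n) →
      ((x : Fin n) → ((+ 3 / 4) + ε) *ℚ toℚ n ≤ℚ toℚ (degree G x)) →
      (v b₁ b₂g : Fin n) → v ≢ b₁ → v ≢ b₂g → b₁ ≢ b₂g →
      ∃[ L ] (Unique L × All (IsRootedSphere G g v b₁ b₂g) L ×
        c *ℚ toℚ (n ^ (2 * g ∸ 1)) ≤ℚ toℚ (length L))))
proposition5p18 g 2≤g ε 0<ε =
  + 1 / Q , positive⁻¹ (+ 1 / Q) {{normalize-pos 1 Q}} , m * (4 ℕ.+ (2 * g ∸ 2)) ,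
  -- The construction does not need the vertices of R to be distinct.
  λ n n₀≤n G min-degree v b₁ b₂g _ _ _ →
    let L , L! , L-rooted , L-large =
          rooted-spheres G m (clear-denominators ε 0<ε ∘ min-degree) g 2≤g n₀≤n v b₁ b₂g
    in  L , L! , L-rooted , ≤-scale Q L-large
  where
  m : ℕ
  m = ↧ₙ ε
  Q : ℕ
  Q = m ^ (2 * g ∸ 1)
  instance
    Q≢0 : ℕ.NonZero Q
    Q≢0 = m^n≢0 m (2 * g ∸ 1)
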